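{- Let $M=\langle W,Q,\{R_w\}_{w\in W},v\rangle$ be a model whose frame belongs to $\mathbf{F}^{dL}$, and let $\Gamma$ be a set of formulas closed under subformulas. Let $M^f_\Gamma$ be the filtration of $M$ through $\Gamma$. Then for every $A\in\Gamma$ and every $w\in W$: $M,w\vDash A$ iff $M^f_\Gamma,[w]_\Gamma\vDash A$.
   Context: Language: variables $p_0,p_1,\dots$ ($\mathrm{Var}$), unary $\neg,\Box,\Diamond$, binary $\wedge,\vee,\rightarrow$; $\mathrm{For}$ its formulas. Demodalization $d$: $d(p)=p$, $d(\neg A)=\neg d(A)$, $d(A\star B)=d(A)\star d(B)$ for $\star\in\{\wedge,\vee,\rightarrow\}$, $d(\Box A)=d(\Diamond A)=d(A)$. A model $\langle W,Q,\{R_w\},v\rangle$: $W\neq\emptyset$, $Q\subseteq W\times W$, $R_w\subseteq\mathrm{For}\times\mathrm{For}$, $v:W\times\mathrm{Var}\to\{0,1\}$. Truth at $w$: $p$ iff $v(w,p)=1$; $\neg,\wedge,\vee$ classical; $\Box B$ iff $B$ true at all $Q$-successors; $\Diamond B$ iff true at some $Q$-successor; $B\rightarrow C$ iff ($B$ false or $C$ true at $w$) and $R_w(B,C)$. $\mathbf{F}^{dL}$: frames $\langle W,Q,\{R_w\}\rangle$ where every $R_w$ satisfies, for all $A,B$: not $R(A,\neg A)$; not $R(\neg A,A)$; $R(A,B)\Rightarrow$ not $R(A,\neg B)$; $R(A\rightarrow B,\neg(A\rightarrow\neg B))$; $R(A\rightarrow\neg B,\neg(A\rightarrow B))$; $R(d(A),d(B))\Rightarrow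 R(A,B)$. $\Gamma$ is closed under subformulas if $A\star B\in\Gamma$ implies $A,B\in\Gamma$ ($\star\in\{\wedge,\vee,\rightarrow\}$) and $\ast A\in\Gamma$ implies $A\in\Gamma$ ($\ast\in\{\neg,\Box,\Diamond\}$). Define $w_1\sim_\Gamma w_2$ iff for all $A,B\in\Gamma$: ($M,w_1\vDash A$ iff $M,w_2\vDash A$) and ($R_{w_1}(A,B)$ iff $R_{w_2}(A,B)$); $[w]_\Gamma$ is the equivalence class of $w$. The filtration $M^f_\Gamma=\langle W^f,Q^f,\{R^f_{[w]_\Gamma}\},v^f\rangle$: $W^f=\{[w]_\Gamma: w\in W\}$; $[w_1]_\Gamma Q^f[w_2]_\Gamma$ iff some $w_1'\in[w_1]_\Gamma$, $w_2'\in[w_2]_\Gamma$ have $Q(w_1',w_2')$; $R^f_{[w]_\Gamma}=\{\langle A,B\rangle\in R_w: A,B\in\Gamma\}$; $v^f([w]_\Gamma,p)=v(w,p)$. -}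

module Defs where

open import Data.Nat using (ℕ)
open import Data.Bool using (Bool; true)
open import Data.Product using (Σ; _×_; _,_; ∃)
open import Data.Sum using (_⊎_)
open import Relation.Nullary using (¬_)
open import Relation.Binary.PropositionalEquality using (_≡_)
open import Function.Bundles using (_⇔_)

data For : Set where
  var  : ℕ → For
  neg  : For → For
  box  : For → For
  dia  : For → For
  _and_ : For → For → For
  _or_  : For → For → For
  _imp_ : For → For → For

d : For → For
d (var p)   = var p
d (neg A)   = neg (d A)
d (box A)   = d A
d (dia A)   = d A
d (A and B) = d A and d B
d (A or B)  = d A or d B
d (A imp B) = d A imp d B

record Frame : Set₁ where
  field
    W : Set
    inhabited : W
    Q : W → W → Set
    R : W → For → For → Set

record Model : Set₁ where
  field
    frame : Frame
  open Frame frame public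
  field
    v : W → ℕ → Bool

module _ (M : Model) where
  open Model M
  Sat : W → For → Set
  Sat w (var p)   = v w p ≡ true
  Sat w (neg A)   = ¬ Sat w A
  Sat w (box A)   = ∀ u → Q w u → Sat u A
  Sat w (dia A)   = Σ W λ u → Q w u × Sat u A
  Sat w (A and B) = Sat w A × Sat w B
  Sat w (A or B)  = Sat w A ⊎ Sat w B
  Sat w (A imp B) = ((¬ Sat w A) ⊎ Sat w B) × R w A B

record dLRel (R : For → For → Set) : Set where
  field
    c1 : ∀ A → ¬ R A (neg A)
    c2 : ∀ A → ¬ R (neg A) A
    c3 : ∀ A B → R A B → ¬ R A (neg B)
    c4 : ∀ A B → R (A imp B) (neg (A imp neg B))
    c5 : ∀ A B → R (A imp neg B) (neg (A imp B))
    c6 : ∀ A B → R (d A) (d B) → R A B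

InFdL : Frame → Set
InFdL F = ∀ w → dLRel (Frame.R F w)

ClosedSub : (For → Set) → Set
ClosedSub Γ =
    (∀ A B → Γ (A and B) → Γ A × Γ B)
  × (∀ A B → Γ (A or B) → Γ A × Γ B)
  × (∀ A B → Γ (A imp B) → Γ A × Γ B)
  × (∀ A → Γ (neg A) → Γ A)
  × (∀ A → Γ (box A) → Γ A)
  × (∀ A → Γ (dia A) → Γ A)

module _ (M : Model) (Γ : For → Set) where
  open Model M
  _∼_ : W → W → Set
  w₁ ∼ w₂ = ∀ A B → Γ A → Γ B →
              (Sat M w₁ A ⇔ Sat M w₂ A) × (R w₁ A B ⇔ R w₂ A B)

  -- Since Agda (without cubical) has no quotient
  -- types, the world [w]_Γ is represented by its representative w; the
  -- filtered model has carrier W, and all its components are defined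
  -- exactly as in the paper in terms of representatives.  (Two
  -- representatives of the same class denote the same world of W^f.)
  filtration : Model
  filtration = record
    { frame = record
      { W = W
      ; inhabited = inhabited
      ; Q = λ w₁ w₂ → Σ W λ w₁' → Σ W λ w₂' → (w₁' ∼ w₁) × (w₂' ∼ w₂) × Q w₁' w₂'
      ; R = λ w A B → R w A B × Γ A × Γ B
      }
    ; v = v
    }

-- The propositional cases are immediate, and the
-- implication case holds because Rᶠ agrees with R on pairs from Γ.  For the
-- modal cases the filtered accessibility relation is the least one through Γ:
-- it contains Q, and a Qᶠ-step [w] → [u] is witnessed by a Q-step between
-- Γ-equivalent worlds, along which □A and ◇A (for □A, ◇A ∈ Γ) transfer.
module Submission where

open import Data.Product using (_×_; _,_; proj₁; proj₂)
open import Data.Product.Function.NonDependent.Propositional using (_×-⇔_)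
open import Data.Sum.Function.Propositional using (_⊎-⇔_)
open import Function.Bundles using (_⇔_; mk⇔; Equivalence)
open import Function.Construct.Identity using (⇔-id)
open import Function.Construct.Symmetry using (⇔-sym)
open import Function.Related.TypeIsomorphisms using (¬-cong-⇔)

open import Defs

module _ (M : Model) (Γ : For → Set) where
  open Model M
  open Equivalence

  Mᶠ : Model
  Mᶠ = filtration M Γ

  module Mᶠ = Model Mᶠ

  ∼-refl : ∀ w → _∼_ M Γ w w
  ∼-refl w A B _ _ = ⇔-id _ , ⇔-id _

  ∼-sym : ∀ {w₁ w₂} → _∼_ M Γ w₁ w₂ → _∼_ M Γ w₂ w₁
  ∼-sym w₁∼w₂ A B γA γB =
    ⇔-sym (proj₁ (w₁∼w₂ A B γA γB)) , ⇔-sym (proj₂ (w₁∼w₂ A B γA γB))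

  ∼-Sat : ∀ {w₁ w₂ A} → _∼_ M Γ w₁ w₂ → Γ A → Sat M w₁ A → Sat M w₂ A
  ∼-Sat {A = A} w₁∼w₂ γA = to (proj₁ (w₁∼w₂ A A γA γA))

  Q⇒Qᶠ : ∀ {w u} → Q w u → Mᶠ.Q w u
  Q⇒Qᶠ {w} {u} wQu = w , u , ∼-refl w , ∼-refl u , wQu

  R⇔Rᶠ : ∀ {w A B} → Γ A → Γ B → R w A B ⇔ Mᶠ.R w A B
  R⇔Rᶠ γA γB = mk⇔ (λ r → r , γA , γB) proj₁

  Qᶠ-□ : ∀ {w u A} → Γ (box A) → Γ A → Sat M w (box A) → Mᶠ.Q w u → Sat M u A
  Qᶠ-□ γ□A γA w⊨□A (w' , u' , w'∼w , u'∼u , w'Qu') =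
    ∼-Sat u'∼u γA (∼-Sat (∼-sym w'∼w) γ□A w⊨□A u' w'Qu')

  Qᶠ-◇ : ∀ {w u A} → Γ (dia A) → Γ A → Mᶠ.Q w u → Sat M u A → Sat M w (dia A)
  Qᶠ-◇ γ◇A γA (w' , u' , w'∼w , u'∼u , w'Qu') u⊨A =
    ∼-Sat w'∼w γ◇A (u' , w'Qu' , ∼-Sat (∼-sym u'∼u) γA u⊨A)

  module _ (closed : ClosedSub Γ) where

    ∧-closed : ∀ A B → Γ (A and B) → Γ A × Γ B
    ∧-closed = proj₁ closed

    ∨-closed : ∀ A B → Γ (A or B) → Γ A × Γ B
    ∨-closed = proj₁ (proj₂ closed)

    →-closed : ∀ A B → Γ (A imp B) → Γ A × Γ B
    →-closed = proj₁ (proj₂ (proj₂ closed))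

    ¬-closed : ∀ A → Γ (neg A) → Γ A
    ¬-closed = proj₁ (proj₂ (proj₂ (proj₂ closed)))

    □-closed : ∀ A → Γ (box A) → Γ A
    □-closed = proj₁ (proj₂ (proj₂ (proj₂ (proj₂ closed))))

    ◇-closed : ∀ A → Γ (dia A) → Γ A
    ◇-closed = proj₂ (proj₂ (proj₂ (proj₂ (proj₂ closed))))

    filtration-lemma : ∀ A → Γ A → ∀ w → Sat M w A ⇔ Sat Mᶠ w A
    filtration-lemma (var p) γ w = ⇔-id _
    filtration-lemma (neg A) γ w = ¬-cong-⇔ (filtration-lemma A (¬-closed A γ) w)
    filtration-lemma (A and B) γ w =
      let γA , γB = ∧-closed A B γ in
      filtration-lemma A γA w ×-⇔ filtration-lemma B γB w
    filtration-lemma (A or B) γ w =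
      let γA , γB = ∨-closed A B γ in
      filtration-lemma A γA w ⊎-⇔ filtration-lemma B γB w
    filtration-lemma (A imp B) γ w =
      let γA , γB = →-closed A B γ in
      (¬-cong-⇔ (filtration-lemma A γA w) ⊎-⇔ filtration-lemma B γB w)
        ×-⇔ R⇔Rᶠ γA γB
    filtration-lemma (box A) γ w = mk⇔
      (λ w⊨□A u wQᶠu → to (IH u) (Qᶠ-□ γ γA w⊨□A wQᶠu))
      (λ w⊨ᶠ□A u wQu → from (IH u) (w⊨ᶠ□A u (Q⇒Qᶠ wQu)))
      where
      γA : Γ A
      γA = □-closed A γ
      IH : ∀ u → Sat M u A ⇔ Sat Mᶠ u A
      IH = filtration-lemma A γA
    filtration-lemma (dia A) γ w = mk⇔
      (λ (u , wQu , u⊨A) → u , Q⇒Qᶠ wQu , to (IH u) u⊨A)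
      (λ (u , wQᶠu , u⊨ᶠA) → Qᶠ-◇ γ γA wQᶠu (from (IH u) u⊨ᶠA))
      where
      γA : Γ A
      γA = ◇-closed A γ
      IH : ∀ u → Sat M u A ⇔ Sat Mᶠ u A
      IH = filtration-lemma A γA

mainTheorem12 : (M : Model) → InFdL (Model.frame M) →
    (Γ : For → Set) → ClosedSub Γ →
    ∀ A → Γ A → (w : Model.W M) →
    Sat M w A ⇔ Sat (filtration M Γ) w A
mainTheorem12 M _ Γ = filtration-lemma M Γ
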